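{- $f\left(\begin{pmatrix}0&0\\1&2\end{pmatrix}\right)=\frac14$.
   Context: Matrices have entries from an arbitrary set of symbols. For an $h\times h$ matrix $H$ and an $n\times n$ matrix $M$ with $n\ge h$, an $h\times h$ submatrix of $M$ is obtained by choosing rows $i_1<\dots<i_h$ and columns $j_1<\dots<j_h$, its $(k,l)$ entry being $M(i_k,j_l)$. The density $d(H,M)$ is the number of $h\times h$ submatrices of $M$ equal to $H$ divided by $\binom{n}{h}^2$. Let $f(H,n)$ be the maximum of $d(H,M)$ over all $n\times n$ matrices $M$, and $f(H)=\lim_{n\to\infty}f(H,n)$. -}

module Defs where

open import Data.Nat using (ℕ; zero; suc; _^_)
open import Data.Nat.Combinatorics using (_C_)
open import Data.Fin using (Fin; zero; suc)
open import Data.Fin.Properties using (all?)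
open import Data.Nat.Properties using (_≟_)
open import Data.Vec using (Vec; []; _∷_; lookup)
import Data.Vec as Vec
open import Data.List using (List; []; _∷_; _++_; map; length; filter; cartesianProductWith)
open import Data.Product using (_×_; _,_)
open import Data.Integer using (+_)
open import Data.Rational using (ℚ; 0ℚ; _/_)
open import Relation.Binary.PropositionalEquality using (_≡_)

Matrix : Set → ℕ → Set
Matrix A n = Fin n → Fin n → A

-- All strictly increasing sequences i₁ < … < i_h of elements of Fin n
-- (i.e. the h-element subsets of Fin n, listed once each).
choose : (h n : ℕ) → List (Vec (Fin n) h)
choose zero    n       = [] ∷ []
choose (suc h) zero    = []
choose (suc h) (suc n) =
  map (Vec.map suc) (choose (suc h) n) ++ map (λ v → zero ∷ Vec.map suc v) (choose h n)

sub : ∀ {A : Set} {h n} → Matrix A n → Vec (Fin n) h → Vec (Fin n) h → Matrix A h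
sub M rs cs k l = M (lookup rs k) (lookup cs l)

count : ∀ {h n} → Matrix ℕ h → Matrix ℕ n → ℕ
count {h} {n} H M =
  length (filter (λ p → let (rs , cs) = p in
                   all? (λ k → all? (λ l → sub M rs cs k l ≟ H k l)))
                 (cartesianProductWith _,_ (choose h n) (choose h n)))

-- c / d as a rational, with the convention c / 0 = 0 (only relevant when n < h).
divℚ : ℕ → ℕ → ℚ
divℚ c zero    = 0ℚ
divℚ c (suc d) = (+ c) / suc d

density : ∀ {h n} → Matrix ℕ h → Matrix ℕ n → ℚ
density {h} {n} H M = divℚ (count H M) ((n C h) ^ 2)

H₀ : Matrix ℕ 2
H₀ zero       zero       = 0
H₀ zero       (suc zero) = 0
H₀ (suc zero) zero       = 1
H₀ (suc zero) (suc zero) = 2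

-- Upper bound: H₀ occurs in rows i < i' and columns j < j' only if, on these two rows,
-- column j reads (0,1) and column j' reads (0,2). If X and Y count such columns, rows i, i'
-- carry at most XY ≤ (X+Y)²/4 ≤ zᵢwᵢ'/4 occurrences, where zᵢ counts the zeros of row i and
-- wᵢ' the nonzero entries of row i'. Summing over i < i' gives at most (Σz)(Σw)/4 ≤ n⁴/16
-- occurrences, against binom(n,2)² = n²(n-1)²/4 submatrices.
-- Lower bound: ⌊n/2⌋ zero rows above rows reading 1 in the first ⌊n/2⌋ columns and 2 in the
-- others contain (⌊n/2⌋⌈n/2⌉)² ≥ binom(n,2)²/4 occurrences, so this density is ≥ 1/4 exactly.

module Submission where

open import Defs
open import Data.Nat using (ℕ; zero; suc; _+_; _*_; _∸_; _^_; _≤_; _>_; _<ᵇ_; z≤n; s≤s; NonZero; >-nonZero)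
open import Data.Nat.Properties
open import Data.Nat.Combinatorics using (_C_; nC1≡n; nCk+nC[k+1]≡[n+1]C[k+1])
open import Data.Nat.Tactic.RingSolver using (solve-∀)
open import Data.Nat.ListAction using () renaming (sum to listSum)
open import Data.Nat.ListAction.Properties using (sum-++)
open import Algebra.Properties.Semiring.Sum +-*-semiring using (sum; sum-cong-≗; ∑-distrib-+; *-distribˡ-sum)
open import Data.Bool using (true; false; if_then_else_)
open import Data.Fin using (Fin; zero; suc; toℕ)
open import Data.Fin.Properties using (all?)
open import Data.Vec using (Vec; []; _∷_)
import Data.Vec as Vec
open import Data.List using ([]; _∷_; _++_; map; length; filter; cartesianProductWith)
open import Data.List.Properties using (map-++; map-∘; map-cong)
open import Data.Product using (_×_; _,_; ∃-syntax; map₂)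
open import Data.Sum using (_⊎_; inj₁; inj₂)
open import Relation.Nullary using (Dec; yes; no; does)
open import Relation.Unary using (Decidable)
open import Data.Integer as ℤ using (+_; +[1+_]; -[1+_])
import Data.Integer.Properties as ℤ
open import Data.Rational using (ℚ; mkℚ; 0ℚ; _/_; *<*)
  renaming (_≤_ to _≤ℚ_; _<_ to _<ℚ_; _+_ to _+ℚ_; _-_ to _-ℚ_)
import Data.Rational.Properties as ℚ
open import Data.Rational.Unnormalised as ℚᵘ using (mkℚᵘ; *≡*)
import Data.Rational.Unnormalised.Properties as ℚᵘ
open import Data.Nat.Coprimality using (Coprime)
open import Relation.Binary.PropositionalEquality
open import Function using (_∘_)

private variable
  n : ℕ

∑< : ∀ n → (Fin n → Fin n → ℕ) → ℕ
∑< zero    f = 0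
∑< (suc n) f = ∑< n (λ i j → f (suc i) (suc j)) + sum (λ j → f zero (suc j))

sum-const : ∀ n c → sum {n} (λ _ → c) ≡ n * c
sum-const zero    c = refl
sum-const (suc n) c = cong (_+_ c) (sum-const n c)

sum-mono-≤ : ∀ {f g : Fin n → ℕ} → (∀ i → f i ≤ g i) → sum f ≤ sum g
sum-mono-≤ {zero}  f≤g = z≤n
sum-mono-≤ {suc n} f≤g = +-mono-≤ (f≤g zero) (sum-mono-≤ (f≤g ∘ suc))

∑<-mono-≤ : ∀ {f g : Fin n → Fin n → ℕ} → (∀ i j → f i j ≤ g i j) → ∑< n f ≤ ∑< n g
∑<-mono-≤ {zero}  f≤g = z≤n
∑<-mono-≤ {suc n} f≤g =
  +-mono-≤ (∑<-mono-≤ (λ i j → f≤g (suc i) (suc j))) (sum-mono-≤ (f≤g zero ∘ suc))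

∑<-zero : ∀ n → ∑< n (λ _ _ → 0) ≡ 0
∑<-zero zero    = refl
∑<-zero (suc n) = cong₂ _+_ (∑<-zero n) (trans (sum-const n 0) (*-zeroʳ n))

∑<-cong : ∀ {f g : Fin n → Fin n → ℕ} → (∀ i j → f i j ≡ g i j) → ∑< n f ≡ ∑< n g
∑<-cong f≡g = ≤-antisym (∑<-mono-≤ (λ i j → ≤-reflexive (f≡g i j)))
                        (∑<-mono-≤ (λ i j → ≤-reflexive (sym (f≡g i j))))

*-distribˡ-∑< : ∀ c (f : Fin n → Fin n → ℕ) → c * ∑< n f ≡ ∑< n (λ i j → c * f i j)
*-distribˡ-∑< {zero}  c f = *-zeroʳ c
*-distribˡ-∑< {suc n} c f = begin
  c * (∑< n rest + sum first)        ≡⟨ *-distribˡ-+ c (∑< n rest) (sum first) ⟩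
  c * ∑< n rest + c * sum first      ≡⟨ cong₂ _+_ (*-distribˡ-∑< c rest) (*-distribˡ-sum c first) ⟩
  ∑< n (λ i j → c * rest i j) + sum (λ j → c * first j) ∎
  where
  open ≡-Reasoning
  rest  = λ i j → f (suc i) (suc j)
  first = λ j → f zero (suc j)

∑<*∑<≡∑<∑< : ∀ (f g : Fin n → Fin n → ℕ) →
  ∑< n f * ∑< n g ≡ ∑< n (λ i i' → ∑< n (λ j j' → f i i' * g j j'))
∑<*∑<≡∑<∑< {n} f g = begin
  ∑< n f * ∑< n g                              ≡⟨ *-comm (∑< n f) (∑< n g) ⟩
  ∑< n g * ∑< n f                              ≡⟨ *-distribˡ-∑< (∑< n g) f ⟩
  ∑< n (λ i i' → ∑< n g * f i i')              ≡⟨ ∑<-cong (λ i i' → *-comm (∑< n g) (f i i')) ⟩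
  ∑< n (λ i i' → f i i' * ∑< n g)              ≡⟨ ∑<-cong (λ i i' → *-distribˡ-∑< (f i i') g) ⟩
  ∑< n (λ i i' → ∑< n (λ j j' → f i i' * g j j')) ∎
  where open ≡-Reasoning

∑<-≤-sum*sum : ∀ (f g : Fin n → ℕ) → ∑< n (λ i j → f i * g j) ≤ sum f * sum g
∑<-≤-sum*sum {zero}  f g = z≤n
∑<-≤-sum*sum {suc n} f g = begin
  ∑< n (λ i j → f (suc i) * g (suc j)) + sum (λ j → f zero * g (suc j))
    ≤⟨ +-mono-≤ (∑<-≤-sum*sum (f ∘ suc) (g ∘ suc)) (≤-reflexive (sym (*-distribˡ-sum (f zero) (g ∘ suc)))) ⟩
  F * G + f zero * G               ≤⟨ m≤m+n _ (g zero * (f zero + F)) ⟩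
  F * G + f zero * G + g zero * (f zero + F) ≡⟨ lemma F G (f zero) (g zero) ⟩
  (f zero + F) * (g zero + G)      ∎
  where
  open ≤-Reasoning
  F = sum (f ∘ suc)
  G = sum (g ∘ suc)
  lemma : ∀ F G x y → F * G + x * G + y * (x + F) ≡ (x + F) * (y + G)
  lemma = solve-∀


indicator : ∀ {a} {P : Set a} → Dec P → ℕ
indicator P? = if does P? then 1 else 0

occurrence : Matrix ℕ 2 → Matrix ℕ n → (i i' j j' : Fin n) → ℕ
occurrence H M i i' j j' =
  indicator (all? λ k → all? λ l → sub M (i ∷ i' ∷ []) (j ∷ j' ∷ []) k l ≟ H k l)

length-filter≡sum : ∀ {A : Set} {p} {P : A → Set p} (P? : Decidable P) xs →
                    length (filter P? xs) ≡ listSum (map (indicator ∘ P?) xs)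
length-filter≡sum P? []       = refl
length-filter≡sum P? (x ∷ xs) with does (P? x)
... | true  = cong suc (length-filter≡sum P? xs)
... | false = length-filter≡sum P? xs

sum-map-++ : ∀ {A : Set} (g : A → ℕ) xs ys → listSum (map g (xs ++ ys)) ≡ listSum (map g xs) + listSum (map g ys)
sum-map-++ g xs ys = trans (cong listSum (map-++ g xs ys)) (sum-++ (map g xs) (map g ys))

sum-cartesianProduct : ∀ {A B : Set} (g : A × B → ℕ) xs ys →
  listSum (map g (cartesianProductWith _,_ xs ys)) ≡ listSum (map (λ x → listSum (map (λ y → g (x , y)) ys)) xs)
sum-cartesianProduct g []       ys = refl
sum-cartesianProduct g (x ∷ xs) ys = begin
  listSum (map g (map (x ,_) ys ++ cartesianProductWith _,_ xs ys))
    ≡⟨ sum-map-++ g (map (x ,_) ys) _ ⟩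
  listSum (map g (map (x ,_) ys)) + listSum (map g (cartesianProductWith _,_ xs ys))
    ≡⟨ cong₂ _+_ (cong listSum (sym (map-∘ ys))) (sum-cartesianProduct g xs ys) ⟩
  listSum (map (λ y → g (x , y)) ys) + listSum (map (λ x → listSum (map (λ y → g (x , y)) ys)) xs) ∎
  where open ≡-Reasoning

sum-choose-1 : ∀ n (g : Vec (Fin n) 1 → ℕ) → listSum (map g (choose 1 n)) ≡ sum (λ j → g (j ∷ []))
sum-choose-1 zero    g = refl
sum-choose-1 (suc n) g = begin
  listSum (map g (map (Vec.map suc) (choose 1 n) ++ ((zero ∷ []) ∷ [])))
    ≡⟨ sum-map-++ g (map (Vec.map suc) (choose 1 n)) _ ⟩
  listSum (map g (map (Vec.map suc) (choose 1 n))) + (g (zero ∷ []) + 0)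
    ≡⟨ cong₂ _+_ (cong listSum (sym (map-∘ (choose 1 n)))) (+-identityʳ _) ⟩
  listSum (map (g ∘ Vec.map suc) (choose 1 n)) + g (zero ∷ [])
    ≡⟨ cong (_+ g (zero ∷ [])) (sum-choose-1 n (g ∘ Vec.map suc)) ⟩
  sum (λ j → g (suc j ∷ [])) + g (zero ∷ [])
    ≡⟨ +-comm _ (g (zero ∷ [])) ⟩
  g (zero ∷ []) + sum (λ j → g (suc j ∷ [])) ∎
  where open ≡-Reasoning

sum-choose-2 : ∀ n (g : Vec (Fin n) 2 → ℕ) → listSum (map g (choose 2 n)) ≡ ∑< n (λ i j → g (i ∷ j ∷ []))
sum-choose-2 zero    g = refl
sum-choose-2 (suc n) g = begin
  listSum (map g (map (Vec.map suc) (choose 2 n) ++ map (λ v → zero ∷ Vec.map suc v) (choose 1 n)))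
    ≡⟨ sum-map-++ g (map (Vec.map suc) (choose 2 n)) _ ⟩
  listSum (map g (map (Vec.map suc) (choose 2 n))) + listSum (map g (map (λ v → zero ∷ Vec.map suc v) (choose 1 n)))
    ≡⟨ cong₂ _+_ (cong listSum (sym (map-∘ (choose 2 n)))) (cong listSum (sym (map-∘ (choose 1 n)))) ⟩
  listSum (map (g ∘ Vec.map suc) (choose 2 n)) + listSum (map (λ v → g (zero ∷ Vec.map suc v)) (choose 1 n))
    ≡⟨ cong₂ _+_ (sum-choose-2 n (g ∘ Vec.map suc)) (sum-choose-1 n (λ v → g (zero ∷ Vec.map suc v))) ⟩
  ∑< (suc n) (λ i j → g (i ∷ j ∷ [])) ∎
  where open ≡-Reasoning

count≡∑<∑<occurrence : ∀ (H : Matrix ℕ 2) (M : Matrix ℕ n) →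
  count H M ≡ ∑< n (λ i i' → ∑< n (λ j j' → occurrence H M i i' j j'))
count≡∑<∑<occurrence {n} H M =
  trans (length-filter≡sum _ (cartesianProductWith _,_ (choose 2 n) (choose 2 n)))
  (trans (sum-cartesianProduct _ (choose 2 n) (choose 2 n))
  (trans (cong listSum (map-cong (λ _ → sum-choose-2 n _) (choose 2 n)))
         (sum-choose-2 n _)))

4*[m*n]≤[m+n]*[m+n] : ∀ m n → 4 * (m * n) ≤ (m + n) * (m + n)
4*[m*n]≤[m+n]*[m+n] zero    n    = z≤n
4*[m*n]≤[m+n]*[m+n] (suc m) zero rewrite *-zeroʳ m = z≤n
4*[m*n]≤[m+n]*[m+n] (suc m) (suc n) = begin
  4 * (suc m * suc n)                     ≡⟨ expand m n ⟩
  4 * (m * n) + 4 * (m + n + 1)           ≤⟨ +-monoˡ-≤ _ (4*[m*n]≤[m+n]*[m+n] m n) ⟩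
  (m + n) * (m + n) + 4 * (m + n + 1)     ≡⟨ square m n ⟩
  (suc m + suc n) * (suc m + suc n)       ∎
  where
  open ≤-Reasoning
  expand : ∀ m n → 4 * ((1 + m) * (1 + n)) ≡ 4 * (m * n) + 4 * (m + n + 1)
  expand = solve-∀
  square : ∀ m n → (m + n) * (m + n) + 4 * (m + n + 1) ≡ (1 + m + (1 + n)) * (1 + m + (1 + n))
  square = solve-∀

δ : ℕ → ℕ → ℕ
δ zero    zero    = 1
δ zero    (suc _) = 0
δ (suc _) zero    = 0
δ (suc m) (suc n) = δ m n

δ-refl : ∀ m → δ m m ≡ 1
δ-refl zero    = refl
δ-refl (suc m) = δ-refl m

indicator-≤ : ∀ {a} {P : Set a} (P? : Dec P) {x} → (P → 1 ≤ x) → indicator P? ≤ x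
indicator-≤ (yes p) 1≤x = 1≤x p
indicator-≤ (no _)  _   = z≤n

occurrence-≤-∏δ : ∀ H (M : Matrix ℕ n) i i' j j' → occurrence H M i i' j j' ≤
  (δ (M i j) (H zero zero) * δ (M i' j) (H (suc zero) zero)) *
  (δ (M i j') (H zero (suc zero)) * δ (M i' j') (H (suc zero) (suc zero)))
occurrence-≤-∏δ H M i i' j j' = indicator-≤ (all? λ k → all? λ l → sub M (i ∷ i' ∷ []) (j ∷ j' ∷ []) k l ≟ H k l) λ match →
  ≤-reflexive (sym (cong₂ _*_ (cong₂ _*_ (δ≡1 (match zero zero)) (δ≡1 (match (suc zero) zero)))
                              (cong₂ _*_ (δ≡1 (match zero (suc zero))) (δ≡1 (match (suc zero) (suc zero))))))
  where
  δ≡1 : ∀ {x y} → x ≡ y → δ x y ≡ 1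
  δ≡1 {x} refl = δ-refl x

zeros nonzeros : Matrix ℕ n → Fin n → ℕ
zeros    M i = sum (λ j → δ (M i j) 0)
nonzeros M i = sum (λ j → 1 ∸ δ (M i j) 0)

zeros+nonzeros≡n : ∀ (M : Matrix ℕ n) i → zeros M i + nonzeros M i ≡ n
zeros+nonzeros≡n {n} M i = begin
  zeros M i + nonzeros M i                  ≡⟨ ∑-distrib-+ (λ j → δ (M i j) 0) (λ j → 1 ∸ δ (M i j) 0) ⟨
  sum (λ j → δ (M i j) 0 + (1 ∸ δ (M i j) 0)) ≡⟨ sum-cong-≗ (λ j → δ-zero+[1∸δ-zero] (M i j)) ⟩
  sum {n} (λ _ → 1)                          ≡⟨ sum-const n 1 ⟩
  n * 1                                      ≡⟨ *-identityʳ n ⟩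
  n                                          ∎
  where
  open ≡-Reasoning
  δ-zero+[1∸δ-zero] : ∀ x → δ x 0 + (1 ∸ δ x 0) ≡ 1
  δ-zero+[1∸δ-zero] zero    = refl
  δ-zero+[1∸δ-zero] (suc _) = refl

4*∑<occurrence≤zeros*nonzeros : ∀ (M : Matrix ℕ n) i i' →
  4 * ∑< n (λ j j' → occurrence H₀ M i i' j j') ≤ zeros M i * nonzeros M i'
4*∑<occurrence≤zeros*nonzeros {n} M i i' = begin
  4 * ∑< n (λ j j' → occurrence H₀ M i i' j j')
    ≤⟨ *-monoʳ-≤ 4 (∑<-mono-≤ (occurrence-≤-∏δ H₀ M i i')) ⟩
  4 * ∑< n (λ j j' → reads01 j * reads02 j')  ≤⟨ *-monoʳ-≤ 4 (∑<-≤-sum*sum reads01 reads02) ⟩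
  4 * (X * Y)                                 ≤⟨ 4*[m*n]≤[m+n]*[m+n] X Y ⟩
  (X + Y) * (X + Y)                           ≤⟨ *-mono-≤ (X+Y≤ zeroOf-i) (X+Y≤ nonzeroOf-i') ⟩
  zeros M i * nonzeros M i'                   ∎
  where
  open ≤-Reasoning
  reads01 reads02 : Fin n → ℕ
  reads01 j = δ (M i j) 0 * δ (M i' j) 1
  reads02 j = δ (M i j) 0 * δ (M i' j) 2
  X = sum reads01
  Y = sum reads02

  X+Y≤ : ∀ {f : Fin n → ℕ} → (∀ j → reads01 j + reads02 j ≤ f j) → X + Y ≤ sum f
  X+Y≤ bound = ≤-trans (≤-reflexive (sym (∑-distrib-+ reads01 reads02))) (sum-mono-≤ bound)

  column-≤-zero : ∀ x y → δ x 0 * δ y 1 + δ x 0 * δ y 2 ≤ δ x 0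
  column-≤-zero zero    zero                = z≤n
  column-≤-zero zero    (suc zero)          = ≤-refl
  column-≤-zero zero    (suc (suc zero))    = ≤-refl
  column-≤-zero zero    (suc (suc (suc _))) = z≤n
  column-≤-zero (suc _) _                   = z≤n

  column-≤-nonzero : ∀ x y → δ x 0 * δ y 1 + δ x 0 * δ y 2 ≤ 1 ∸ δ y 0
  column-≤-nonzero zero    zero                = z≤n
  column-≤-nonzero zero    (suc zero)          = ≤-refl
  column-≤-nonzero zero    (suc (suc zero))    = ≤-refl
  column-≤-nonzero zero    (suc (suc (suc _))) = z≤n
  column-≤-nonzero (suc _) _                   = z≤n

  zeroOf-i : ∀ j → reads01 j + reads02 j ≤ δ (M i j) 0
  zeroOf-i j = column-≤-zero (M i j) (M i' j)

  nonzeroOf-i' : ∀ j → reads01 j + reads02 j ≤ 1 ∸ δ (M i' j) 0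
  nonzeroOf-i' j = column-≤-nonzero (M i j) (M i' j)

16*count≤[n*n]*[n*n] : ∀ (M : Matrix ℕ n) → 16 * count H₀ M ≤ (n * n) * (n * n)
16*count≤[n*n]*[n*n] {n} M = begin
  16 * count H₀ M                                         ≡⟨ cong (16 *_) (count≡∑<∑<occurrence H₀ M) ⟩
  4 * 4 * ∑< n (λ i i' → ∑< n (occurrence H₀ M i i'))      ≡⟨ *-assoc 4 4 (∑< n (λ i i' → ∑< n (occurrence H₀ M i i'))) ⟩
  4 * (4 * ∑< n (λ i i' → ∑< n (occurrence H₀ M i i')))    ≡⟨ cong (4 *_) (*-distribˡ-∑< 4 (λ i i' → ∑< n (occurrence H₀ M i i'))) ⟩
  4 * ∑< n (λ i i' → 4 * ∑< n (occurrence H₀ M i i'))      ≤⟨ *-monoʳ-≤ 4 (∑<-mono-≤ (4*∑<occurrence≤zeros*nonzeros M)) ⟩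
  4 * ∑< n (λ i i' → zeros M i * nonzeros M i')           ≤⟨ *-monoʳ-≤ 4 (∑<-≤-sum*sum (zeros M) (nonzeros M)) ⟩
  4 * (sum (zeros M) * sum (nonzeros M))                  ≤⟨ 4*[m*n]≤[m+n]*[m+n] (sum (zeros M)) (sum (nonzeros M)) ⟩
  (sum (zeros M) + sum (nonzeros M)) * (sum (zeros M) + sum (nonzeros M))
    ≡⟨ cong (λ s → s * s) total ⟩
  (n * n) * (n * n)                                       ∎
  where
  open ≤-Reasoning
  total : sum (zeros M) + sum (nonzeros M) ≡ n * n
  total = trans (sym (∑-distrib-+ (zeros M) (nonzeros M)))
                (trans (sum-cong-≗ (zeros+nonzeros≡n M)) (sum-const n n))

below above : ℕ → Fin n → ℕ
below a i = if toℕ i <ᵇ a then 1 else 0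
above a i = 1 ∸ below a i

block : ℕ → Matrix ℕ n
block a i j = if toℕ i <ᵇ a then 0 else if toℕ j <ᵇ a then 1 else 2

below*above-≤-occurrence : ∀ a (i i' j j' : Fin n) →
  (below a i * above a i') * (below a j * above a j') ≤ occurrence H₀ (block a) i i' j j'
below*above-≤-occurrence a i i' j j'
  with toℕ i <ᵇ a | toℕ i' <ᵇ a | toℕ j <ᵇ a | toℕ j' <ᵇ a
... | false | _     | _     | _     = z≤n
... | true  | true  | _     | _     = z≤n
... | true  | false | false | _     = z≤n
... | true  | false | true  | true  = z≤n
... | true  | false | true  | false = ≤-refl

sum-above : ∀ a b → sum {a + b} (above a) ≡ b
sum-above zero    b = trans (sum-const b 1) (*-identityʳ b)
sum-above (suc a) b = sum-above a b

∑<-below*above : ∀ a b → ∑< (a + b) (λ i i' → below a i * above a i') ≡ a * b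
∑<-below*above zero    b = ∑<-zero b
∑<-below*above (suc a) b = begin
  ∑< (a + b) (λ i i' → below a i * above a i') + sum {a + b} (λ i' → 1 * above a i')
    ≡⟨ cong₂ _+_ (∑<-below*above a b) (trans (sum-cong-≗ {a + b} (λ i' → *-identityˡ (above a i'))) (sum-above a b)) ⟩
  a * b + b  ≡⟨ +-comm (a * b) b ⟩
  suc a * b  ∎
  where open ≡-Reasoning

[a*b]*[a*b]≤count-block : ∀ a b → (a * b) * (a * b) ≤ count H₀ (block {a + b} a)
[a*b]*[a*b]≤count-block a b = begin
  (a * b) * (a * b)             ≡⟨ cong₂ _*_ (∑<-below*above a b) (∑<-below*above a b) ⟨
  ∑< m L * ∑< m L               ≡⟨ ∑<*∑<≡∑<∑< L L ⟩
  ∑< m (λ i i' → ∑< m (λ j j' → L i i' * L j j'))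
    ≤⟨ ∑<-mono-≤ {m} (λ i i' → ∑<-mono-≤ (below*above-≤-occurrence a i i')) ⟩
  ∑< m (λ i i' → ∑< m (occurrence H₀ (block a) i i')) ≡⟨ count≡∑<∑<occurrence H₀ (block {m} a) ⟨
  count H₀ (block {m} a)        ∎
  where
  open ≤-Reasoning
  m = a + b
  L : Fin m → Fin m → ℕ
  L i i' = below a i * above a i'

2*nC2+n≡n*n : ∀ n → 2 * (n C 2) + n ≡ n * n
2*nC2+n≡n*n zero    = refl
2*nC2+n≡n*n (suc n) = begin
  2 * (suc n C 2) + suc n      ≡⟨ cong (λ c → 2 * c + suc n) (nCk+nC[k+1]≡[n+1]C[k+1] n 1) ⟨
  2 * (n C 1 + n C 2) + suc n  ≡⟨ cong (λ c → 2 * (c + n C 2) + suc n) (nC1≡n n) ⟩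
  2 * (n + n C 2) + suc n      ≡⟨ regroup n (n C 2) ⟩
  (2 * (n C 2) + n) + (2 * n + 1) ≡⟨ cong (_+ (2 * n + 1)) (2*nC2+n≡n*n n) ⟩
  n * n + (2 * n + 1)          ≡⟨ square n ⟩
  suc n * suc n                ∎
  where
  open ≡-Reasoning
  regroup : ∀ n c → 2 * (n + c) + suc n ≡ (2 * c + n) + (2 * n + 1)
  regroup = solve-∀
  square : ∀ n → n * n + (2 * n + 1) ≡ suc n * suc n
  square = solve-∀

nC2>0 : ∀ {n} → 2 ≤ n → n C 2 > 0
nC2>0 {suc (suc n)} (s≤s (s≤s _)) = ≤-trans (s≤s z≤n) (≤-trans (m≤m+n (suc n) (suc n C 2))
  (≤-reflexive (trans (cong (_+ suc n C 2) (sym (nC1≡n (suc n)))) (nCk+nC[k+1]≡[n+1]C[k+1] (suc n) 1))))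

[1+n]²*s≤[s+4]*n² : ∀ n s → s ≤ n → (suc n * suc n) * s ≤ (s + 4) * (n * n)
[1+n]²*s≤[s+4]*n² n s s≤n = begin
  (suc n * suc n) * s              ≡⟨ expand n s ⟩
  n * n * s + (2 * n + 1) * s      ≤⟨ +-monoʳ-≤ (n * n * s) (*-monoʳ-≤ (2 * n + 1) s≤n) ⟩
  n * n * s + (2 * n + 1) * n      ≤⟨ +-monoʳ-≤ (n * n * s) ([2n+1]*n≤4*n*n n) ⟩
  n * n * s + 4 * (n * n)          ≡⟨ collect n s ⟩
  (s + 4) * (n * n)                ∎
  where
  open ≤-Reasoning
  expand : ∀ n s → (1 + n) * (1 + n) * s ≡ n * n * s + (2 * n + 1) * s
  expand = solve-∀
  collect : ∀ n s → n * n * s + 4 * (n * n) ≡ (s + 4) * (n * n)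
  collect = solve-∀
  [2n+1]*n≤4*n*n : ∀ n → (2 * n + 1) * n ≤ 4 * (n * n)
  [2n+1]*n≤4*n*n zero    = z≤n
  [2n+1]*n≤4*n*n (suc k) = ≤-trans (m≤m+n _ ((1 + k) * (2 * k + 1))) (≤-reflexive (difference k))
    where
    difference : ∀ k → (2 * (1 + k) + 1) * (1 + k) + (1 + k) * (2 * k + 1) ≡ 4 * ((1 + k) * (1 + k))
    difference = solve-∀

balanced-square : ∀ {a b} → b ≡ a ⊎ b ≡ suc a → (a + b) * (a + b) ≤ 4 * (a * b) + (a + b)
balanced-square {a} (inj₁ refl) = ≤-trans (≤-reflexive (square a)) (m≤m+n (4 * (a * a)) (a + a))
  where
  square : ∀ a → (a + a) * (a + a) ≡ 4 * (a * a)
  square = solve-∀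
balanced-square {a} (inj₂ refl) = ≤-trans (m≤m+n _ (2 * a)) (≤-reflexive (square a))
  where
  square : ∀ a → (a + (1 + a)) * (a + (1 + a)) + 2 * a ≡ 4 * (a * (1 + a)) + (a + (1 + a))
  square = solve-∀

balanced-split : ∀ n → ∃[ a ] ∃[ b ] (n ≡ a + b × (b ≡ a ⊎ b ≡ suc a))
balanced-split zero = 0 , 0 , refl , inj₁ refl
balanced-split (suc n) with balanced-split n
... | a , .a       , n≡a+a    , inj₁ refl = a , suc a , trans (cong suc n≡a+a) (sym (+-suc a a)) , inj₂ refl
... | a , .(suc a) , n≡a+1+a  , inj₂ refl = suc a , suc a , cong suc n≡a+1+a , inj₁ refl

divℚ-mono-≤ : ∀ {c c' d d'} .{{_ : NonZero d}} .{{_ : NonZero d'}} →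
              c * d' ≤ c' * d → divℚ c d ≤ℚ divℚ c' d'
divℚ-mono-≤ {c} {c'} {suc d} {suc d'} cd'≤c'd = ℚ.toℚᵘ-cancel-≤
  (ℚᵘ.≤-respˡ-≃ (ℚᵘ.≃-sym (ℚ.toℚᵘ-fromℚᵘ (mkℚᵘ (+ c) d)))
  (ℚᵘ.≤-respʳ-≃ (ℚᵘ.≃-sym (ℚ.toℚᵘ-fromℚᵘ (mkℚᵘ (+ c') d')))
  (ℚᵘ.*≤* (subst₂ ℤ._≤_ (ℤ.pos-* c (suc d')) (ℤ.pos-* c' (suc d)) (ℤ.+≤+ cd'≤c'd)))))

¼+p/[1+q]≡divℚ : ∀ p q .(cop : Coprime p (suc q)) →
                 + 1 / 4 +ℚ mkℚ (+ p) q cop ≡ divℚ (suc q + p * 4) (4 * suc q)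
¼+p/[1+q]≡divℚ p q cop = ℚ.toℚᵘ-injective (ℚᵘ.≃-trans
  (ℚ.toℚᵘ-homo-+ (+ 1 / 4) (mkℚ (+ p) q cop))
  (ℚᵘ.≃-trans (*≡* (cong (ℤ._* + (4 * suc q)) numerator))
               (ℚᵘ.≃-sym (ℚ.toℚᵘ-fromℚᵘ (mkℚᵘ (+ (suc q + p * 4)) (q + 3 * suc q))))))
  where
  numerator : + 1 ℤ.* + suc q ℤ.+ + p ℤ.* + 4 ≡ + (suc q + p * 4)
  numerator = begin
    + 1 ℤ.* + suc q ℤ.+ + p ℤ.* + 4   ≡⟨ cong₂ ℤ._+_ (ℤ.*-identityˡ (+ suc q)) (sym (ℤ.pos-* p 4)) ⟩
    + suc q ℤ.+ + (p * 4)             ≡⟨ ℤ.pos-+ (suc q) (p * 4) ⟨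
    + (suc q + p * 4)                 ∎
    where open ≡-Reasoning

p-q≤p : ∀ p {q} → 0ℚ ≤ℚ q → p -ℚ q ≤ℚ p
p-q≤p p 0≤q = ℚ.≤-trans (ℚ.+-monoʳ-≤ p (ℚ.neg-antimono-≤ 0≤q)) (ℚ.≤-reflexive (ℚ.+-identityʳ p))

density-H₀-≤ : ∀ (M : Matrix ℕ n) p q → 1 ≤ p → 2 + q ≤ n →
               density H₀ M ≤ℚ divℚ (suc q + p * 4) (4 * suc q)
density-H₀-≤ {n@(suc (suc m))} M p q 1≤p (s≤s (s≤s q≤m)) =
  divℚ-mono-≤ {count H₀ M} {suc q + p * 4} {B ^ 2} {4 * suc q} {{B²≢0}} (*-cancelˡ-≤ 4 (begin
    4 * (count H₀ M * (4 * S))             ≡⟨ regroup (count H₀ M) S ⟩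
    16 * count H₀ M * S                    ≤⟨ *-monoˡ-≤ S (16*count≤[n*n]*[n*n] M) ⟩
    (n * n) * (n * n) * S                  ≡⟨ *-assoc (n * n) (n * n) S ⟩
    (n * n) * ((n * n) * S)                ≤⟨ *-monoʳ-≤ (n * n) ([1+n]²*s≤[s+4]*n² (suc m) S (s≤s q≤m)) ⟩
    (n * n) * ((S + 4) * (suc m * suc m))  ≡⟨ regroup′ n (suc m) S ⟩
    (S + 4) * ((n * suc m) * (n * suc m))  ≡⟨ cong (λ x → (S + 4) * (x * x)) 2*B≡n*[n-1] ⟨
    (S + 4) * ((2 * B) * (2 * B))          ≡⟨ regroup″ S B ⟩
    4 * ((S + 4) * B ^ 2)                  ≤⟨ *-monoʳ-≤ 4 (*-monoˡ-≤ (B ^ 2) (+-monoʳ-≤ S (*-monoˡ-≤ 4 1≤p))) ⟩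
    4 * ((S + p * 4) * B ^ 2)              ∎))
  where
  open ≤-Reasoning
  S = suc q
  B = n C 2
  B²≢0 : NonZero (B ^ 2)
  B²≢0 = m^n≢0 B 2 {{>-nonZero (nC2>0 {n} (s≤s (s≤s z≤n)))}}
  2*B≡n*[n-1] : 2 * B ≡ n * suc m
  2*B≡n*[n-1] = +-cancelʳ-≡ n (2 * B) (n * suc m) 
    (trans (2*nC2+n≡n*n n) (trans (*-suc n (suc m)) (+-comm n (n * suc m))))
  regroup : ∀ c S → 4 * (c * (4 * S)) ≡ 16 * c * S
  regroup = solve-∀
  regroup′ : ∀ n m S → (n * n) * ((S + 4) * (m * m)) ≡ (S + 4) * ((n * m) * (n * m))
  regroup′ = solve-∀
  regroup″ : ∀ S B → (S + 4) * ((2 * B) * (2 * B)) ≡ 4 * ((S + 4) * (B * (B * 1)))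
  regroup″ = solve-∀

¼≤density-block : ∀ a b → 2 ≤ a + b → b ≡ a ⊎ b ≡ suc a → + 1 / 4 ≤ℚ density H₀ (block {a + b} a)
¼≤density-block a b 2≤a+b balanced =
  divℚ-mono-≤ {1} {count H₀ (block {a + b} a)} {4} {B ^ 2} {{_}} {{B²≢0}} (begin
    1 * B ^ 2                            ≡⟨ *-identityˡ (B ^ 2) ⟩
    B * (B * 1)                          ≤⟨ *-mono-≤ B≤2ab (*-monoˡ-≤ 1 B≤2ab) ⟩
    2 * (a * b) * (2 * (a * b) * 1)      ≡⟨ regroup (a * b) ⟩
    (a * b) * (a * b) * 4                ≤⟨ *-monoˡ-≤ 4 ([a*b]*[a*b]≤count-block a b) ⟩
    count H₀ (block {a + b} a) * 4       ∎)
  where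
  open ≤-Reasoning
  B = (a + b) C 2
  B²≢0 : NonZero (B ^ 2)
  B²≢0 = m^n≢0 B 2 {{>-nonZero (nC2>0 2≤a+b)}}
  regroup : ∀ x → 2 * x * (2 * x * 1) ≡ x * x * 4
  regroup = solve-∀
  B≤2ab : B ≤ 2 * (a * b)
  B≤2ab = *-cancelˡ-≤ 2 (+-cancelʳ-≤ (a + b) (2 * B) (2 * (2 * (a * b))) (begin
    2 * B + (a + b)                ≡⟨ 2*nC2+n≡n*n (a + b) ⟩
    (a + b) * (a + b)              ≤⟨ balanced-square balanced ⟩
    4 * (a * b) + (a + b)          ≡⟨ cong (_+ (a + b)) (*-assoc 2 2 (a * b)) ⟩
    2 * (2 * (a * b)) + (a + b)    ∎))

¼≤density-H₀ : ∀ n → 2 ≤ n → ∃[ M ] (+ 1 / 4 ≤ℚ density {2} {n} H₀ M)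
¼≤density-H₀ n 2≤n with balanced-split n
... | a , b , refl , balanced = block a , ¼≤density-block a b 2≤n balanced

lemma2 : (ε : ℚ) → 0ℚ <ℚ ε →
    ∃[ N ] ((n : ℕ) → N ≤ n →
    ((M : Matrix ℕ n) → density H₀ M ≤ℚ (+ 1 / 4) +ℚ ε)
    × (∃[ M ] ((+ 1 / 4) -ℚ ε ≤ℚ density {2} {n} H₀ M)))
lemma2 (mkℚ (+ zero) _ _) (*<* (ℤ.+<+ ()))
lemma2 (mkℚ -[1+ _ ] _ _) (*<* ())
lemma2 ε@(mkℚ +[1+ k ] q cop) 0<ε = 2 + q , λ n 2+q≤n → upper 2+q≤n , lower n 2+q≤n
  where
  upper : ∀ {n} → 2 + q ≤ n → (M : Matrix ℕ n) → density H₀ M ≤ℚ (+ 1 / 4) +ℚ ε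
  upper 2+q≤n M = subst (density H₀ M ≤ℚ_) (sym (¼+p/[1+q]≡divℚ (suc k) q cop))
                        (density-H₀-≤ M (suc k) q (s≤s z≤n) 2+q≤n)
  lower : ∀ n → 2 + q ≤ n → ∃[ M ] ((+ 1 / 4) -ℚ ε ≤ℚ density {2} {n} H₀ M)
  lower n 2+q≤n = map₂ (ℚ.≤-trans (p-q≤p (+ 1 / 4) (ℚ.<⇒≤ 0<ε)))
                       (¼≤density-H₀ n (≤-trans (s≤s (s≤s z≤n)) 2+q≤n))
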